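{- In an alternative-cycle graph $ACG(\pi,\tau,f)$ with $\pi=[x_0,\dots,x_{n+1}]$, if for every $0\le i\le n$ a green edge is added joining the nodes $r(x_i)$ and $l(x_{i+1})$, then all the blue edges together with all the green edges form a single path alternating between blue and green edges.
   Context: Fix genes $\Sigma_1$ and repeats $\Sigma_2\ni r_0$. A chromosome is a sequence $\pi=[x_0,\dots,x_{n+1}]$ of signed symbols ($x_i=\pm a$, $|x_i|=a$) with $x_0=+r_0$, $x_{n+1}=-r_0$, every gene occurring exactly once. Nodes are labelled $(l(x_i),r(x_i))=(a^h,a^t)$ if $x_i=+a$, $(a^t,a^h)$ if $x_i=-a$. Adjacencies: unordered pairs $\langle r(x_i),l(x_{i+1})\rangle$ at the gaps $0\le i\le n$; $\mathcal{A}[\pi]$ is their multiset. Let $\pi,\tau$ be related chromosomes with $\mathcal{A}[\pi]=\mathcal{A}[\tau]$. $ACG(\pi,\tau,f)$: $f$ is a bijection between the gaps of $\pi$ and of $\tau$ sending each adjacency to an identical one (left end matched to left end, right end to right end). For each occurrence $x_i$ of $\pi$ create two distinct nodes $l(x_i),r(x_i)$ joined by a red edge. For each occurrence $y_k$ of $\tau$: among the nodes of $\pi$ bordering the gap matched to the left gap of $y_k$ take the one labelled $l(y_k)$, among those bordering the gap matched to the right gap of $y_k$ take the one labelled $r(y_k)$, and join them by a blue edge. -}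

module Defs where

open import Data.Nat using (ℕ; zero; suc)
open import Data.Fin using (Fin; zero; suc; toℕ; inject₁; fromℕ)
open import Data.Sum using (_⊎_; inj₁; inj₂)
open import Data.Product using (_×_; _,_; Σ; proj₁; proj₂)
open import Data.Bool using (Bool; true; false; if_then_else_)
open import Data.Maybe using (Maybe; just; nothing)
import Data.Maybe as Maybe
open import Relation.Binary.PropositionalEquality using (_≡_; _≢_)
open import Function.Bundles using (_↔_; Inverse)
open import Function.Definitions using (Injective; Bijective)

data Sign : Set where
  ⊕ ⊖ : Sign

data Ext : Set where
  hd tl : Ext

SignedSym : Set → Set → Set
SignedSym G R = Sign × (G ⊎ R)

Label : Set → Set → Set
Label G R = (G ⊎ R) × Ext

lab-l : ∀ {G R} → SignedSym G R → Label G R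
lab-l (⊕ , a) = a , hd
lab-l (⊖ , a) = a , tl

lab-r : ∀ {G R} → SignedSym G R → Label G R
lab-r (⊕ , a) = a , tl
lab-r (⊖ , a) = a , hd

record Chromosome (G R : Set) (r₀ : R) (n : ℕ) : Set where
  field
    x : Fin (suc (suc n)) → SignedSym G R
    first : x zero ≡ (⊕ , inj₂ r₀)
    last  : x (fromℕ (suc n)) ≡ (⊖ , inj₂ r₀)
    gene-once : ∀ (g : G) → Σ (Fin (suc (suc n))) λ i →
                  (proj₂ (x i) ≡ inj₁ g) × (∀ j → proj₂ (x j) ≡ inj₁ g → j ≡ i)
open Chromosome public

-- Gap i (0 ≤ i ≤ n), i : Fin (suc n), lies between x_i = x (inject₁ i)
-- and x_{i+1} = x (suc i); its adjacency is ⟨ r(x_i) , l(x_{i+1}) ⟩,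
-- written here as (left end , right end).
gapEnds : ∀ {G R r₀ n} → Chromosome G R r₀ n → Fin (suc n) → Label G R × Label G R
gapEnds π i = lab-r (x π (inject₁ i)) , lab-l (x π (suc i))

-- Identical (unordered) adjacencies, with the matching of their ends:
-- crossed = false : left end ↦ left end, right end ↦ right end;
-- crossed = true  : left end ↦ right end, right end ↦ left end.
EndsMatch : ∀ {G R} → Bool → Label G R × Label G R → Label G R × Label G R → Set
EndsMatch false (a , b) (c , d) = (a ≡ c) × (b ≡ d)
EndsMatch true  (a , b) (c , d) = (a ≡ d) × (b ≡ c)

-- The data f of ACG(π,τ,f): a bijection between gaps of π and gaps of τ
-- sending each adjacency to an identical one, together with the matching
-- of the ends of matched adjacencies.
record ACGMatching {G R : Set} {r₀ : R} {n m : ℕ}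
                   (π : Chromosome G R r₀ n) (τ : Chromosome G R r₀ m) : Set where
  field
    f       : Fin (suc n) ↔ Fin (suc m)
    crossed : Fin (suc n) → Bool
    matches : ∀ i → EndsMatch (crossed i) (gapEnds π i) (gapEnds τ (Inverse.to f i))
open ACGMatching public

-- Nodes of ACG(π,τ,f): l(x_i) and r(x_i) for every occurrence x_i of π

data Side : Set where
  lft rgt : Side

Node : ℕ → Set
Node n = Fin (suc (suc n)) × Side

leftGap : ∀ {m} → Fin (suc m) → Maybe (Fin m)
leftGap zero    = nothing
leftGap (suc k) = just k

rightGap : ∀ {m} → Fin (suc m) → Maybe (Fin m)
rightGap {zero}  zero    = nothing
rightGap {suc m} zero    = just zero
rightGap {suc m} (suc k) = Maybe.map suc (rightGap k)

module _ {G R : Set} {r₀ : R} {n m : ℕ}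
         {π : Chromosome G R r₀ n} {τ : Chromosome G R r₀ m}
         (F : ACGMatching π τ) where

  nodeMatchedToRightEnd : Fin (suc m) → Node n
  nodeMatchedToRightEnd j with Inverse.from (f F) j
  ... | i = if crossed F i then (inject₁ i , rgt) else (suc i , lft)

  nodeMatchedToLeftEnd : Fin (suc m) → Node n
  nodeMatchedToLeftEnd j with Inverse.from (f F) j
  ... | i = if crossed F i then (suc i , lft) else (inject₁ i , rgt)

  -- Blue edge of occurrence y_k.  Boundary convention: y₀ = +r₀ has no left
  -- gap, its l-end is the node l(x₀); y_{m+1} = -r₀ has no right gap, its
  -- r-end is the node r(x_{n+1}).
  blueL : Fin (suc (suc m)) → Node n
  blueL k with leftGap k
  ... | nothing = zero , lft
  ... | just j  = nodeMatchedToRightEnd j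

  blueR : Fin (suc (suc m)) → Node n
  blueR k with rightGap k
  ... | nothing = fromℕ (suc n) , rgt
  ... | just j  = nodeMatchedToLeftEnd j

  greenEnds : Fin (suc n) → Node n × Node n
  greenEnds i = (inject₁ i , rgt) , (suc i , lft)

  -- blue edges (indexed by occurrences of τ) and green edges (indexed by gaps of π)
  BGEdge : Set
  BGEdge = Fin (suc (suc m)) ⊎ Fin (suc n)

  bgEnds : BGEdge → Node n × Node n
  bgEnds (inj₁ k) = blueL k , blueR k
  bgEnds (inj₂ i) = greenEnds i

data Colour : Set where
  blue green : Colour

bgColour : ∀ {A B : Set} → A ⊎ B → Colour
bgColour (inj₁ _) = blue
bgColour (inj₂ _) = green

Joins : ∀ {N : Set} → N × N → N → N → Set
Joins (a , b) u v = ((a ≡ u) × (b ≡ v)) ⊎ ((a ≡ v) × (b ≡ u))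

record AlternatingPath {N E : Set} (ends : E → N × N) (colour : E → Colour) : Set where
  field
    len        : ℕ
    node       : Fin (suc len) → N
    edge       : Fin len → E
    node-inj   : Injective _≡_ _≡_ node
    edge-bij   : Bijective _≡_ _≡_ edge
    joins      : ∀ j → Joins (ends (edge j)) (node (inject₁ j)) (node (suc j))
    alternates : ∀ (j k : Fin len) → toℕ k ≡ suc (toℕ j) → colour (edge j) ≢ colour (edge k)

-- Read τ from left to right. The blue edge of y₀ leaves l(x₀) and ends at a
-- node bordering the π-gap f⁻¹(0); the green edge of that gap leads to the
-- other node bordering it, which is where the blue edge of y₁ starts, and so
-- on, until the blue edge of y_{m+1} ends at r(x_{n+1}). Since f is a
-- bijection every green edge is traversed exactly once, and the visited nodes
-- are distinct because a node borders at most one gap.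
module Submission where

open import Defs
open import Data.Nat using (ℕ; zero; suc; _*_)
open import Data.Fin using (Fin; zero; suc; toℕ; inject₁; fromℕ)
open import Data.Fin.Properties
  using (0≢1+n; suc-injective; inject₁-injective; fromℕ≢inject₁)
open import Data.Bool using (Bool; true; false; not; if_then_else_)
open import Data.Bool.Properties using (not-¬)
open import Data.Maybe using (just; nothing; maybe′)
open import Data.Maybe.Properties using (maybe′-map)
open import Data.Sum using (inj₁; inj₂)
open import Data.Sum.Properties using (inj₂-injective)
open import Data.Product using (_×_; _,_; proj₁; map)
open import Data.Vec.Functional using (Vector; []; _∷_; tail)
open import Data.Vec.Functional.Relation.Unary.All using (All)
open import Data.Vec.Functional.Relation.Unary.Any using (Any)
open import Function using (_∘_; id)
open import Function.Bundles using (Inverse; Injection)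
open import Function.Definitions using (Injective; StrictlySurjective)
open import Function.Consequences.Propositional using (strictlySurjective⇒surjective)
open import Function.Properties.Inverse using (↔-sym; Inverse⇒Injection)
open import Relation.Binary.PropositionalEquality
open import Relation.Nullary using (contradiction)

private
  variable
    A : Set
    k : ℕ

infixl 5 _∷ʳ_

_∷ʳ_ : Vector A k → A → Vector A (suc k)
_∷ʳ_ {k = zero}  xs z = z ∷ []
_∷ʳ_ {k = suc k} xs z = xs zero ∷ (tail xs ∷ʳ z)

interleave : Vector A k → Vector A k → Vector A (k * 2)
interleave {k = zero}  xs ys = []
interleave {k = suc k} xs ys = xs zero ∷ ys zero ∷ interleave (tail xs) (tail ys)

module _ (P : A → Set) where

  all-∷ : ∀ {x} {xs : Vector A k} → P x → All P xs → All P (x ∷ xs)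
  all-∷ px pxs zero    = px
  all-∷ px pxs (suc i) = pxs i

  all-∷ʳ : ∀ {xs : Vector A k} {z} → All P xs → P z → All P (xs ∷ʳ z)
  all-∷ʳ {k = zero}  pxs pz = all-∷ pz λ ()
  all-∷ʳ {k = suc k} pxs pz = all-∷ (pxs zero) (all-∷ʳ (pxs ∘ suc) pz)

  all-interleave : ∀ {xs ys : Vector A k} → All P xs → All P ys → All P (interleave xs ys)
  all-interleave {k = zero}  pxs pys ()
  all-interleave {k = suc k} pxs pys =
    all-∷ (pxs zero) (all-∷ (pys zero) (all-interleave (pxs ∘ suc) (pys ∘ suc)))

  any-interleaveˡ : ∀ {xs ys : Vector A k} → Any P xs → Any P (interleave xs ys)
  any-interleaveˡ {k = suc k} (zero , px) = zero , px
  any-interleaveˡ {k = suc k} (suc i , px) with any-interleaveˡ {k = k} (i , px)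
  ... | p , px′ = suc (suc p) , px′

  any-interleaveʳ : ∀ {xs ys : Vector A k} → Any P ys → Any P (interleave xs ys)
  any-interleaveʳ {k = suc k} (zero , py) = suc zero , py
  any-interleaveʳ {k = suc k} (suc j , py) with any-interleaveʳ {k = k} (j , py)
  ... | p , py′ = suc (suc p) , py′

tail-∌-head : {xs : Vector A (suc k)} → Injective _≡_ _≡_ xs → All (_≢ xs zero) (tail xs)
tail-∌-head xs-inj i eq = 0≢1+n (sym (xs-inj eq))

∷-injective : ∀ {x} {xs : Vector A k} →
  All (_≢ x) xs → Injective _≡_ _≡_ xs → Injective _≡_ _≡_ (x ∷ xs)
∷-injective x∉xs xs-inj {zero}  {zero}  eq = refl
∷-injective x∉xs xs-inj {zero}  {suc j} eq = contradiction (sym eq) (x∉xs j)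
∷-injective x∉xs xs-inj {suc i} {zero}  eq = contradiction eq (x∉xs i)
∷-injective x∉xs xs-inj {suc i} {suc j} eq = cong suc (xs-inj eq)

∷ʳ-injective : ∀ {xs : Vector A k} {z} →
  Injective _≡_ _≡_ xs → All (_≢ z) xs → Injective _≡_ _≡_ (xs ∷ʳ z)
∷ʳ-injective {k = zero}  xs-inj z∉xs = ∷-injective (λ ()) (λ { {()} })
∷ʳ-injective {k = suc k} {xs} xs-inj z∉xs =
  ∷-injective (all-∷ʳ (_≢ xs zero) (tail-∌-head xs-inj) (z∉xs zero ∘ sym))
              (∷ʳ-injective (suc-injective ∘ xs-inj) (z∉xs ∘ suc))

interleave-injective : ∀ {xs ys : Vector A k} →
  Injective _≡_ _≡_ xs → Injective _≡_ _≡_ ys → (∀ i j → xs i ≢ ys j) →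
  Injective _≡_ _≡_ (interleave xs ys)
interleave-injective {k = zero} xs-inj ys-inj disjoint {()}
interleave-injective {k = suc k} {xs} {ys} xs-inj ys-inj disjoint =
  ∷-injective x₀∉rest
    (∷-injective y₀∉rest
      (interleave-injective (suc-injective ∘ xs-inj) (suc-injective ∘ ys-inj)
                            (λ i j → disjoint (suc i) (suc j))))
  where
  x₀∉rest : All (_≢ xs zero) (ys zero ∷ interleave (tail xs) (tail ys))
  x₀∉rest = all-∷ (_≢ xs zero) (disjoint zero zero ∘ sym)
    (all-interleave (_≢ xs zero) (tail-∌-head xs-inj) (λ j → disjoint zero (suc j) ∘ sym))

  y₀∉rest : All (_≢ ys zero) (interleave (tail xs) (tail ys))
  y₀∉rest = all-interleave (_≢ ys zero) (λ i → disjoint (suc i) zero) (tail-∌-head ys-inj)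

interleave-walk : ∀ {N E : Set} (ends : E → N × N)
  {as bs : Vector N k} {z : N} {gs hs : Vector E k} →
  (∀ j → Joins (ends (gs j)) (as j) (bs j)) →
  (∀ j → Joins (ends (hs j)) (bs j) ((as ∷ʳ z) (suc j))) →
  ∀ p → Joins (ends (interleave gs hs p))
              ((interleave as bs ∷ʳ z) (inject₁ p)) ((interleave as bs ∷ʳ z) (suc p))
interleave-walk {k = suc k}       ends gs-joins hs-joins zero          = gs-joins zero
interleave-walk {k = suc zero}    ends gs-joins hs-joins (suc zero)    = hs-joins zero
interleave-walk {k = suc (suc k)} ends gs-joins hs-joins (suc zero)    = hs-joins zero
interleave-walk {k = suc (suc k)} ends gs-joins hs-joins (suc (suc p)) =
  interleave-walk ends (gs-joins ∘ suc) (hs-joins ∘ suc) p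

other : Colour → Colour
other blue  = green
other green = blue

other-involutive : ∀ c → other (other c) ≡ c
other-involutive blue  = refl
other-involutive green = refl

≢-other : ∀ c → c ≢ other c
≢-other blue  ()
≢-other green ()

alternating : Colour → ℕ → Colour
alternating c zero    = c
alternating c (suc i) = other (alternating c i)

alternating-other : ∀ c i → alternating (other c) i ≡ other (alternating c i)
alternating-other c zero    = refl
alternating-other c (suc i) = cong other (alternating-other c i)

interleave-alternating : ∀ {E : Set} (colour : E → Colour) {c} {gs hs : Vector E k} →
  All ((_≡ c) ∘ colour) gs → All ((_≡ other c) ∘ colour) hs →
  ∀ p → colour (interleave gs hs p) ≡ alternating c (toℕ p)
interleave-alternating {k = suc k} colour     gs-c hs-c zero          = gs-c zero
interleave-alternating {k = suc k} colour     gs-c hs-c (suc zero)    = hs-c zero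
interleave-alternating {k = suc k} colour {c} {gs} {hs} gs-c hs-c (suc (suc p)) =
  begin
  colour (interleave (tail gs) (tail hs) p)
    ≡⟨ interleave-alternating colour (gs-c ∘ suc) (hs-c ∘ suc) p ⟩
  alternating c (toℕ p)
    ≡⟨ other-involutive _ ⟨
  alternating c (toℕ (suc (suc p)))
    ∎
  where open ≡-Reasoning

maybe′-rightGap : ∀ (g : Vector A k) z (i : Fin (suc k)) → maybe′ g z (rightGap i) ≡ (g ∷ʳ z) i
maybe′-rightGap {k = zero}  g z zero    = refl
maybe′-rightGap {k = suc k} g z zero    = refl
maybe′-rightGap {k = suc k} g z (suc i) =
  trans (maybe′-map g z suc (rightGap i)) (maybe′-rightGap (tail g) z i)

borderNode : ∀ {n} → Fin (suc n) → Bool → Node n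
borderNode i b = if b then (suc i , lft) else (inject₁ i , rgt)

module _ {n : ℕ} where

  borderNode-injective : ∀ {i i′ : Fin (suc n)} {b b′} →
    borderNode i b ≡ borderNode i′ b′ → i ≡ i′ × b ≡ b′
  borderNode-injective {b = false} {false} eq = inject₁-injective (cong proj₁ eq) , refl
  borderNode-injective {b = true}  {true}  eq = suc-injective (cong proj₁ eq) , refl
  borderNode-injective {b = false} {true}  ()
  borderNode-injective {b = true}  {false} ()

  borderNode≢start : ∀ (i : Fin (suc n)) b → borderNode i b ≢ (zero , lft)
  borderNode≢start i false ()
  borderNode≢start i true  ()

  borderNode≢final : ∀ (i : Fin (suc n)) b → borderNode i b ≢ (fromℕ (suc n) , rgt)
  borderNode≢final i false eq = fromℕ≢inject₁ (cong proj₁ (sym eq))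
  borderNode≢final i true  ()

  joins-borderNodes : ∀ (i : Fin (suc n)) b →
    Joins ((inject₁ i , rgt) , (suc i , lft)) (borderNode i b) (borderNode i (not b))
  joins-borderNodes i false = inj₁ (refl , refl)
  joins-borderNodes i true  = inj₂ (refl , refl)

module ACGPath {G R : Set} {r₀ : R} {n m : ℕ}
               {π : Chromosome G R r₀ n} {τ : Chromosome G R r₀ m}
               (F : ACGMatching π τ) where

  from : Fin (suc m) → Fin (suc n)
  from = Inverse.from (f F)

  from-injective : Injective _≡_ _≡_ from
  from-injective = Injection.injective (Inverse⇒Injection (↔-sym (f F)))

  -- leftEnd j is nodeMatchedToLeftEnd F j, definitionally.
  leftEnd rightEnd : Fin (suc m) → Node n
  leftEnd  j = borderNode (from j) (crossed F (from j))
  rightEnd j = borderNode (from j) (not (crossed F (from j)))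

  rightEnd-matched : ∀ j → nodeMatchedToRightEnd F j ≡ rightEnd j
  rightEnd-matched j with crossed F (from j)
  ... | false = refl
  ... | true  = refl

  start final : Node n
  start = zero , lft
  final = fromℕ (suc n) , rgt

  blueR-∷ʳ : ∀ k → blueR F k ≡ (leftEnd ∷ʳ final) k
  blueR-∷ʳ k = trans (blueR≡maybe′ k) (maybe′-rightGap leftEnd final k)
    where
    blueR≡maybe′ : ∀ k → blueR F k ≡ maybe′ leftEnd final (rightGap k)
    blueR≡maybe′ k with rightGap k
    ... | nothing = refl
    ... | just j  = refl

  len : ℕ
  len = suc (suc m * 2)

  nodes : Fin (suc len) → Node n
  nodes = start ∷ (interleave leftEnd rightEnd ∷ʳ final)

  greens blues : Fin (suc m) → BGEdge F
  greens j = inj₂ (from j)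
  blues  j = inj₁ (suc j)

  edges : Fin len → BGEdge F
  edges = inj₁ zero ∷ interleave greens blues

  leftEnd-injective : Injective _≡_ _≡_ leftEnd
  leftEnd-injective = from-injective ∘ proj₁ ∘ borderNode-injective

  rightEnd-injective : Injective _≡_ _≡_ rightEnd
  rightEnd-injective = from-injective ∘ proj₁ ∘ borderNode-injective

  leftEnd≢rightEnd : ∀ i j → leftEnd i ≢ rightEnd j
  leftEnd≢rightEnd i j eq with borderNode-injective eq
  ... | i≡j , c≡¬c rewrite from-injective i≡j = not-¬ refl c≡¬c

  ends≢start : All (_≢ start) (interleave leftEnd rightEnd)
  ends≢start = all-interleave (_≢ start) {xs = leftEnd} {rightEnd}
    (λ j → borderNode≢start (from j) _) (λ j → borderNode≢start (from j) _)

  ends≢final : All (_≢ final) (interleave leftEnd rightEnd)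
  ends≢final = all-interleave (_≢ final) {xs = leftEnd} {rightEnd}
    (λ j → borderNode≢final (from j) _) (λ j → borderNode≢final (from j) _)

  nodes-injective : Injective _≡_ _≡_ nodes
  nodes-injective = ∷-injective (all-∷ʳ (_≢ start) ends≢start λ ())
    (∷ʳ-injective (interleave-injective leftEnd-injective rightEnd-injective leftEnd≢rightEnd)
                  ends≢final)

  edges-injective : Injective _≡_ _≡_ edges
  edges-injective =
    ∷-injective (all-interleave (_≢ inj₁ zero) {xs = greens} {blues} (λ _ ()) (λ _ ()))
      (interleave-injective {xs = greens} {blues}
        (from-injective ∘ inj₂-injective) (λ { refl → refl }) (λ _ _ ()))

  edges-strictlySurjective : StrictlySurjective _≡_ edges
  edges-strictlySurjective (inj₁ zero)    = zero , refl
  edges-strictlySurjective (inj₁ (suc j)) =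
    map suc id (any-interleaveʳ (_≡ inj₁ (suc j)) {xs = greens} {blues} (j , refl))
  edges-strictlySurjective (inj₂ i)       =
    map suc id (any-interleaveˡ (_≡ inj₂ i) {xs = greens} {blues}
      (Inverse.to (f F) i , cong inj₂ (Inverse.strictlyInverseʳ (f F) i)))

  edges-joins : ∀ p → Joins (bgEnds F (edges p)) (nodes (inject₁ p)) (nodes (suc p))
  edges-joins zero    = inj₁ (refl , blueR-∷ʳ zero)
  edges-joins (suc p) = interleave-walk (bgEnds F) {gs = greens} {blues}
    (λ j → joins-borderNodes (from j) (crossed F (from j)))
    (λ j → inj₁ (rightEnd-matched j , blueR-∷ʳ (suc j)))
    p

  edges-alternating : ∀ p → bgColour (edges p) ≡ alternating blue (toℕ p)
  edges-alternating zero    = refl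
  edges-alternating (suc p) =
    trans (interleave-alternating bgColour {gs = greens} {blues} (λ _ → refl) (λ _ → refl) p)
          (alternating-other blue (toℕ p))

  edges-alternate : ∀ j k → toℕ k ≡ suc (toℕ j) → bgColour (edges j) ≢ bgColour (edges k)
  edges-alternate j k k≡1+j
    rewrite edges-alternating j | edges-alternating k | k≡1+j = ≢-other _

  path : AlternatingPath (bgEnds F) bgColour
  path = record
    { len        = len
    ; node       = nodes
    ; edge       = edges
    ; node-inj   = nodes-injective
    ; edge-bij   = edges-injective , strictlySurjective⇒surjective edges-strictlySurjective
    ; joins      = edges-joins
    ; alternates = edges-alternate
    }

lemma11 : ∀ {G R : Set} {r₀ : R} {n m : ℕ}
    (π : Chromosome G R r₀ n) (τ : Chromosome G R r₀ m) (F : ACGMatching π τ) →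
    AlternatingPath (bgEnds F) bgColour
lemma11 π τ F = ACGPath.path F
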